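{- Let $w\in\{a,b\}^+$ be an open Sturmian word. Then $|w|=H_w+K_w$; equivalently, $w=uv$ where $u$ is the shortest unrepeated prefix of $w$ and $v$ is the shortest unrepeated suffix of $w$.
   Context: A finite word over $\{a,b\}$ is Sturmian if it is a factor of some Sturmian infinite word (an infinite binary word with exactly $n+1$ distinct factors of each length $n$). A word $u$ is closed if $u$ is a single letter or $u$ contains exactly two occurrences of some nonempty proper factor, one as a prefix and one as a suffix; otherwise it is open. A prefix (suffix) of $w$ is unrepeated if it occurs only once in $w$; $H_w$ (resp. $K_w$) is the length of the shortest unrepeated prefix (resp. suffix) of $w$. -}

module Defs where

open import Data.Nat using (ℕ; zero; suc; _+_; _∸_; _<_; _≤_)
open import Data.Bool using (Bool; true; false)
open import Data.List using (List; []; _∷_; length; map; upTo; take; drop; _++_)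
open import Data.List.Membership.Propositional using (_∈_)
open import Data.List.Relation.Unary.Unique.Propositional using (Unique)
open import Data.Product using (Σ; ∃; _×_; _,_)
open import Data.Sum using (_⊎_)
open import Function.Bundles using (_⇔_)
open import Relation.Binary.PropositionalEquality using (_≡_; _≢_)
open import Relation.Nullary using (¬_)

data Letter : Set where
  a b : Letter

Word : Set
Word = List Letter

_==ᴸ_ : Letter → Letter → Bool
a ==ᴸ a = true
b ==ᴸ b = true
_ ==ᴸ _ = false

isPrefixᵇ : Word → Word → Bool
isPrefixᵇ [] _ = true
isPrefixᵇ (_ ∷ _) [] = false
isPrefixᵇ (x ∷ v) (y ∷ w) with x ==ᴸ y
... | true = isPrefixᵇ v w
... | false = false

-- occ v w : number of occurrences of v in w (number of positions i, 0 ≤ i ≤ |w|,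
-- such that v is a prefix of the suffix of w starting at i)
occ : Word → Word → ℕ
occ v [] with isPrefixᵇ v []
... | true = 1
... | false = 0
occ v (y ∷ w) with isPrefixᵇ v (y ∷ w)
... | true = suc (occ v w)
... | false = occ v w

IsPrefix : Word → Word → Set
IsPrefix v w = ∃ λ s → v ++ s ≡ w

IsSuffix : Word → Word → Set
IsSuffix v w = ∃ λ p → p ++ v ≡ w

InfWord : Set
InfWord = ℕ → Letter

factorAt : InfWord → ℕ → ℕ → Word
factorAt x i n = map (λ j → x (i + j)) (upTo n)

SturmianInf : InfWord → Set
SturmianInf x = ∀ n → Σ (List Word) λ L →
  length L ≡ suc n × Unique L × (∀ u → (u ∈ L) ⇔ (∃ λ i → factorAt x i n ≡ u))

Sturmian : Word → Set
Sturmian w = Σ InfWord λ x → SturmianInf x × (∃ λ i → factorAt x i (length w) ≡ w)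

Closed : Word → Set
Closed u = length u ≡ 1 ⊎
  (∃ λ v → v ≢ [] × length v < length u × occ v u ≡ 2 × IsPrefix v u × IsSuffix v u)

Open : Word → Set
Open u = ¬ Closed u

Unrepeated : Word → Word → Set
Unrepeated v w = occ v w ≡ 1

IsH : Word → ℕ → Set
IsH w h = h ≤ length w × Unrepeated (take h w) w
        × (∀ m → m < h → ¬ Unrepeated (take m w) w)

suffixOf : ℕ → Word → Word
suffixOf k w = drop (length w ∸ k) w

IsK : Word → ℕ → Set
IsK w k = k ≤ length w × Unrepeated (suffixOf k w) w
        × (∀ m → m < k → ¬ Unrepeated (suffixOf m w) w)

-- Let h = H_w and k = K_w.  A factor of w without left extension occurs only as a prefix,
-- and the prefixes shorter than h are repeated, so the factors without left extension are
-- exactly the prefixes of length ≥ h.  Counting the factors of length i + 1 by their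
-- suffix of length i gives d(i + 1) = d(i) + s(i) − [h ≤ i], where d(i) counts the factors
-- and s(i) the left special factors of length i; as d(|w|) = 1, this telescopes to
-- |w| − h = s(0) + ⋯ + s(|w| − 1).  Openness makes the suffix S of length k − 1 left
-- special, and its prefixes give s(i) ≥ 1 for i < k, hence |w| ≥ h + k.  When k ≤ h the
-- Sturmian bound d(k) ≤ k + 1 leaves room for only one left special factor of each length
-- below k, so none is longer than S (it would extend the unrepeated suffix of length k to
-- the right) and |w| ≤ h + k.  When h ≤ k the same argument applies to the reversal of w,
-- with the right special prefix of length h − 1 in place of S.
module Submission where

open import Defs
open import Data.Bool using (Bool; true; false; _∧_; not)
open import Data.Empty using (⊥; ⊥-elim)
open import Data.List
  using (List; []; _∷_; length; take; drop; _++_; reverse; map; concatMap; upTo; applyUpTo)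
open import Data.List.Membership.Propositional using (_∈_)
open import Data.List.Membership.Propositional.Properties
  using (∈-map⁻; ∈-∃++; ∈-++⁻; ∈-++⁺ˡ; ∈-++⁺ʳ)
open import Data.List.Properties
  using (≡-dec; ++-assoc; ++-identityʳ; ++-conicalˡ; ++-conicalʳ; ∷-injective; ∷-injectiveʳ;
         length-++; length-drop; length-take; length-map; length-reverse; take-take; take++drop≡id;
         drop-all; reverse-++; reverse-involutive; reverse-injective; unfold-reverse;
         map-upTo; map-∘; map-cong)
import Data.List.Relation.Unary.All as All
import Data.List.Relation.Unary.AllPairs as AP
open import Data.List.Relation.Unary.Any using (here; there)
open import Data.List.Relation.Unary.Unique.Propositional using (Unique)
open import Data.List.Relation.Unary.Unique.Propositional.Properties using (map⁺; ++⁺)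
open import Data.Nat using (ℕ; zero; suc; _+_; _∸_; _<_; _≤_; z≤n; s≤s; _≟_; _≤?_; _<?_)
open import Data.Nat.ListAction using (sum)
open import Data.Nat.Properties
  using (suc-injective; 1+n≢0; 1+n≰n; n<1⇒n≡0; n≤1+n; n<1+n; m<n⇒m<1+n; ≤-pred;
         ≤-refl; ≤-reflexive; ≤-trans; ≤-antisym; ≤-total; <-irrefl; <⇒≤; <⇒≱; ≰⇒>; ≮⇒≥;
         m≤n⇒m<n∨m≡n; m≤m+n; m≤n+m; +-identityʳ; +-assoc; +-comm; +-suc;
         +-cancelˡ-≡; +-cancelˡ-≤; +-mono-≤; +-monoˡ-≤; +-monoʳ-≤; m+n≡0⇒m≡0; m+n≡0⇒n≡0;
         0∸n≡0; m+n∸n≡m; m∸[m∸n]≡n; m+[n∸m]≡n; +-∸-assoc; m≤n⇒m∸n≡0; m∸n≡0⇒m≤n;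
         m≤n⇒m⊓n≡m; +-commutativeSemigroup; module ≤-Reasoning)
open import Algebra.Properties.CommutativeSemigroup +-commutativeSemigroup
  using (x∙yz≈y∙xz; xy∙z≈xz∙y; interchange)
open import Data.Product using (∃; ∃₂; _×_; _,_; proj₁; proj₂)
open import Data.Sum using (_⊎_; inj₁; inj₂)
open import Function using (_∘_)
open import Function.Bundles using (Equivalence)
open import Relation.Binary.Definitions using (DecidableEquality)
open import Relation.Binary.PropositionalEquality
open import Relation.Nullary using (¬_; Dec; yes; no; does)
open import Relation.Nullary.Decidable using (map′)

private variable
  x y W : Word
  c : Letter

_≟ᴸ_ : DecidableEquality Letter
a ≟ᴸ a = yes refl
a ≟ᴸ b = no λ ()
b ≟ᴸ a = no λ ()
b ≟ᴸ b = yes refl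

_≟ᵂ_ : DecidableEquality Word
_≟ᵂ_ = ≡-dec _≟ᴸ_

other : Letter → Letter
other a = b
other b = a

≢⇒other : ∀ {c e} → e ≢ c → e ≡ other c
≢⇒other {a} {a} e≢c = ⊥-elim (e≢c refl)
≢⇒other {a} {b} _   = refl
≢⇒other {b} {a} _   = refl
≢⇒other {b} {b} e≢c = ⊥-elim (e≢c refl)

infix 4 _⊑_
_⊑_ : Word → Word → Set
x ⊑ W = ∃₂ λ p s → p ++ x ++ s ≡ W

prefix⇒factor : IsPrefix x W → x ⊑ W
prefix⇒factor (s , e) = [] , s , e

suffix⇒factor : IsSuffix x W → x ⊑ W
suffix⇒factor {x} (p , e) = p , [] , trans (cong (p ++_) (++-identityʳ x)) e

occurrence⇒suffix : ∀ p → p ++ x ++ [] ≡ W → IsSuffix x W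
occurrence⇒suffix {x} p e = p , trans (cong (p ++_) (sym (++-identityʳ x))) e

factor-[] : x ⊑ [] → x ≡ []
factor-[] (p , s , e) = ++-conicalˡ _ s (++-conicalʳ p _ e)

factor-∷ : x ⊑ (c ∷ W) → IsPrefix x (c ∷ W) ⊎ x ⊑ W
factor-∷ ([] , s , e)    = inj₁ (s , e)
factor-∷ (_ ∷ p , s , e) = inj₂ (p , s , ∷-injectiveʳ e)

factor-++ˡ : ∀ x y → (x ++ y) ⊑ W → x ⊑ W
factor-++ˡ x y (p , s , e) = p , y ++ s , trans (cong (p ++_) (sym (++-assoc x y s))) e

factor-++ʳ : ∀ x y → (x ++ y) ⊑ W → y ⊑ W
factor-++ʳ x y (p , s , e) =
  p ++ x , s , trans (++-assoc p x (y ++ s)) (trans (cong (p ++_) (sym (++-assoc x y s))) e)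

factor-take : ∀ m x → x ⊑ W → take m x ⊑ W
factor-take m x f = factor-++ˡ (take m x) (drop m x) (subst (_⊑ _) (sym (take++drop≡id m x)) f)

occurrence-length : ∀ p x s → p ++ x ++ s ≡ W → length p + length x + length s ≡ length W
occurrence-length p x s refl =
  trans (+-assoc (length p) _ _) (trans (cong (length p +_) (sym (length-++ x))) (sym (length-++ p)))

suffix-position : ∀ p x → p ++ x ++ [] ≡ W → length p ≡ length W ∸ length x
suffix-position {W} p x e = begin
  length p                           ≡⟨ sym (m+n∸n≡m (length p) (length x)) ⟩
  length p + length x ∸ length x     ≡⟨ cong (_∸ length x) (sym (+-identityʳ _)) ⟩
  length p + length x + 0 ∸ length x ≡⟨ cong (_∸ length x) (occurrence-length p x [] e) ⟩
  length W ∸ length x                ∎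
  where open ≡-Reasoning

factor-there : x ⊑ W → x ⊑ (c ∷ W)
factor-there {c = c} (p , s , e) = c ∷ p , s , cong (c ∷_) e

==ᴸ-sound : ∀ c d → (c ==ᴸ d) ≡ true → c ≡ d
==ᴸ-sound a a _ = refl
==ᴸ-sound b b _ = refl

==ᴸ-refl : ∀ c → (c ==ᴸ c) ≡ true
==ᴸ-refl a = refl
==ᴸ-refl b = refl

isPrefixᵇ-sound : ∀ x W → isPrefixᵇ x W ≡ true → IsPrefix x W
isPrefixᵇ-sound [] W _ = W , refl
isPrefixᵇ-sound (c ∷ x) (d ∷ W) eq with c ==ᴸ d in c=d
... | true with isPrefixᵇ-sound x W eq
...   | s , refl rewrite ==ᴸ-sound c d c=d = s , refl

isPrefixᵇ-complete : ∀ x W → IsPrefix x W → isPrefixᵇ x W ≡ true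
isPrefixᵇ-complete [] W _ = refl
isPrefixᵇ-complete (c ∷ x) .(c ∷ x ++ s) (s , refl) rewrite ==ᴸ-refl c =
  isPrefixᵇ-complete x (x ++ s) (s , refl)

isPrefix? : ∀ x W → Dec (IsPrefix x W)
isPrefix? x W with isPrefixᵇ x W in eq
... | true  = yes (isPrefixᵇ-sound x W eq)
... | false = no λ pre → true≢false (trans (sym (isPrefixᵇ-complete x W pre)) eq)
  where true≢false : true ≢ false
        true≢false ()

occ-prefix : IsPrefix x (c ∷ W) → occ x (c ∷ W) ≡ suc (occ x W)
occ-prefix {x} {c} {W} pre with isPrefixᵇ x (c ∷ W) | isPrefixᵇ-complete x (c ∷ W) pre
... | true | _ = refl

occ-nonprefix : ¬ IsPrefix x (c ∷ W) → occ x (c ∷ W) ≡ occ x W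
occ-nonprefix {x} {c} {W} ¬pre with isPrefixᵇ x (c ∷ W) in eq
... | true  = ⊥-elim (¬pre (isPrefixᵇ-sound x (c ∷ W) eq))
... | false = refl

occ-∷ : ∀ x c W → occ x W ≤ occ x (c ∷ W)
occ-∷ x c W with isPrefix? x (c ∷ W)
... | yes pre  = subst (occ x W ≤_) (sym (occ-prefix pre)) (n≤1+n (occ x W))
... | no ¬pre = ≤-reflexive (sym (occ-nonprefix ¬pre))

occ-[] : ∀ W → occ [] W ≡ suc (length W)
occ-[] []      = refl
occ-[] (c ∷ W) = cong suc (occ-[] W)

factor⇒occurs : x ⊑ W → 1 ≤ occ x W
factor⇒occurs {W = []} f rewrite factor-[] f = ≤-refl
factor⇒occurs {x} {c ∷ W} f with factor-∷ f
... | inj₁ pre = subst (1 ≤_) (sym (occ-prefix pre)) (s≤s z≤n)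
... | inj₂ f′  = ≤-trans (factor⇒occurs f′) (occ-∷ x c W)

occurs⇒factor : ∀ x W → 1 ≤ occ x W → x ⊑ W
occurs⇒factor []      []      _ = [] , [] , refl
occurs⇒factor x (c ∷ W) occurs with isPrefix? x (c ∷ W)
... | yes pre  = prefix⇒factor pre
... | no ¬pre = factor-there (occurs⇒factor x W (subst (1 ≤_) (occ-nonprefix ¬pre) occurs))

_⊑?_ : ∀ x W → Dec (x ⊑ W)
x ⊑? W = map′ (occurs⇒factor x W) factor⇒occurs (1 ≤? occ x W)

non-factor⇒occ≡0 : ∀ x W → ¬ x ⊑ W → occ x W ≡ 0
non-factor⇒occ≡0 x W ¬f = n<1⇒n≡0 (≰⇒> (¬f ∘ occurs⇒factor x W))

SinglePosition : Word → Word → Set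
SinglePosition x W =
  ∀ p₁ s₁ p₂ s₂ → p₁ ++ x ++ s₁ ≡ W → p₂ ++ x ++ s₂ ≡ W → length p₁ ≡ length p₂

two-positions⇒repeated : ∀ p₁ s₁ p₂ s₂ → p₁ ++ x ++ s₁ ≡ W → p₂ ++ x ++ s₂ ≡ W →
                         length p₁ ≢ length p₂ → 2 ≤ occ x W
two-positions⇒repeated [] _ [] _ _ _ p₁≢p₂ = ⊥-elim (p₁≢p₂ refl)
two-positions⇒repeated [] s₁ (c ∷ p₂) s₂ e₁ refl _ =
  subst (2 ≤_) (sym (occ-prefix (s₁ , e₁))) (s≤s (factor⇒occurs (p₂ , s₂ , refl)))
two-positions⇒repeated (c ∷ p₁) s₁ [] s₂ refl e₂ _ =
  subst (2 ≤_) (sym (occ-prefix (s₂ , e₂))) (s≤s (factor⇒occurs (p₁ , s₁ , refl)))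
two-positions⇒repeated {x} (c ∷ p₁) s₁ (_ ∷ p₂) s₂ refl e₂ p₁≢p₂ =
  ≤-trans (two-positions⇒repeated p₁ s₁ p₂ s₂ refl (∷-injectiveʳ e₂) (p₁≢p₂ ∘ cong suc))
          (occ-∷ x c (p₁ ++ x ++ s₁))

unrepeated⇒single-position : Unrepeated x W → SinglePosition x W
unrepeated⇒single-position once p₁ s₁ p₂ s₂ e₁ e₂ with length p₁ ≟ length p₂
... | yes same = same
... | no differ =
  ⊥-elim (1+n≰n (subst (2 ≤_) once (two-positions⇒repeated p₁ s₁ p₂ s₂ e₁ e₂ differ)))

single-position⇒unrepeated : x ⊑ W → SinglePosition x W → Unrepeated x W
single-position⇒unrepeated {W = []} f _ rewrite factor-[] f = refl
single-position⇒unrepeated {x} {c ∷ W} f single with isPrefix? x (c ∷ W)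
... | yes pre@(s , e) = trans (occ-prefix pre) (cong suc (non-factor⇒occ≡0 x W λ (p′ , s′ , e′) →
        1+n≢0 (single (c ∷ p′) s′ [] s (cong (c ∷_) e′) e)))
... | no ¬pre with factor-∷ f
...   | inj₁ pre = ⊥-elim (¬pre pre)
...   | inj₂ f′  = trans (occ-nonprefix ¬pre) (single-position⇒unrepeated f′ λ p₁ s₁ p₂ s₂ e₁ e₂ →
          suc-injective (single (c ∷ p₁) s₁ (c ∷ p₂) s₂ (cong (c ∷_) e₁) (cong (c ∷_) e₂)))

length≡0⇒[] : length x ≡ 0 → x ≡ []
length≡0⇒[] {[]}    _  = refl
length≡0⇒[] {_ ∷ _} ()

prefix-occurrences⇒unrepeated : x ⊑ W → (∀ p s → p ++ x ++ s ≡ W → p ≡ []) → Unrepeated x W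
prefix-occurrences⇒unrepeated f only = single-position⇒unrepeated f λ p₁ s₁ p₂ s₂ e₁ e₂ →
  trans (cong length (only p₁ s₁ e₁)) (sym (cong length (only p₂ s₂ e₂)))

suffix-occurrences⇒unrepeated : ∀ x → x ⊑ W → (∀ p s → p ++ x ++ s ≡ W → s ≡ []) →
                                Unrepeated x W
suffix-occurrences⇒unrepeated {W} x f only =
  single-position⇒unrepeated f λ p₁ s₁ p₂ s₂ e₁ e₂ → trans (position p₁ s₁ e₁) (sym (position p₂ s₂ e₂))
  where
    position : ∀ p s → p ++ x ++ s ≡ W → length p ≡ length W ∸ length x
    position p s e with only p s e
    ... | refl = suffix-position p x e

unrepeated-prefix-occurrence : Unrepeated x W → IsPrefix x W → ∀ p s → p ++ x ++ s ≡ W → p ≡ []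
unrepeated-prefix-occurrence once (s₀ , e₀) p s e =
  length≡0⇒[] (unrepeated⇒single-position once p s [] s₀ e e₀)

unrepeated-suffix-occurrence : Unrepeated x W → IsSuffix x W → ∀ p s → p ++ x ++ s ≡ W → s ≡ []
unrepeated-suffix-occurrence {x} {W} once (p₀ , e₀) p s e =
  length≡0⇒[] (+-cancelˡ-≡ (length p + length x) (length s) 0 (begin
    length p + length x + length s   ≡⟨ occurrence-length p x s e ⟩
    length W                         ≡⟨ sym (occurrence-length p₀ x [] e₀′) ⟩
    length p₀ + length x + 0         ≡⟨ cong (λ m → m + length x + 0) same ⟩
    length p + length x + 0          ∎))
  where
    open ≡-Reasoning
    e₀′ : p₀ ++ x ++ [] ≡ W
    e₀′ = trans (cong (p₀ ++_) (++-identityʳ x)) e₀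
    same : length p₀ ≡ length p
    same = unrepeated⇒single-position once p₀ [] p s e₀′ e

suffixOf-isSuffix : ∀ k (W : Word) → IsSuffix (suffixOf k W) W
suffixOf-isSuffix k W = take (length W ∸ k) W , take++drop≡id (length W ∸ k) W

suffixOf-length : ∀ {k} (W : Word) → k ≤ length W → length (suffixOf k W) ≡ k
suffixOf-length {k} W k≤|W| = trans (length-drop (length W ∸ k) W) (m∸[m∸n]≡n k≤|W|)

suffix⇒suffixOf : IsSuffix x W → suffixOf (length x) W ≡ x
suffix⇒suffixOf {x} {W} (p , e) = begin
  drop (length W ∸ length x) W    ≡⟨ cong (λ m → drop m W) (sym (suffix-position p x e′)) ⟩
  drop (length p) W               ≡⟨ cong (drop (length p)) (sym e) ⟩
  drop (length p) (p ++ x)        ≡⟨ drop-length-++ p ⟩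
  x                               ∎
  where
    open ≡-Reasoning
    e′ : p ++ x ++ [] ≡ W
    e′ = trans (cong (p ++_) (++-identityʳ x)) e
    drop-length-++ : ∀ p → drop (length p) (p ++ x) ≡ x
    drop-length-++ []      = refl
    drop-length-++ (_ ∷ p) = drop-length-++ p

isSuffix? : ∀ x W → Dec (IsSuffix x W)
isSuffix? x W = map′ (λ e → subst (λ v → IsSuffix v W) e (suffixOf-isSuffix (length x) W))
                     suffix⇒suffixOf (suffixOf (length x) W ≟ᵂ x)

OnlyAtEnds : Word → Word → Set
OnlyAtEnds x W = ∀ p s → p ++ x ++ s ≡ W → p ≡ [] ⊎ s ≡ []

border-occurs-twice : IsPrefix x W → IsSuffix x W → length x < length W → OnlyAtEnds x W →
                      occ x W ≡ 2
border-occurs-twice {W = []} _ _ () _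
border-occurs-twice {x} {c ∷ W} _ ([] , x≡cW) |x|<|cW| _ =
  ⊥-elim (<-irrefl (cong length x≡cW) |x|<|cW|)
border-occurs-twice {x} {c ∷ W} pre (_ ∷ p , e) _ ends = trans (occ-prefix pre)
  (cong suc (suffix-occurrences⇒unrepeated x (suffix⇒factor (p , ∷-injectiveʳ e)) only-suffix))
  where
    only-suffix : ∀ p s → p ++ x ++ s ≡ W → s ≡ []
    only-suffix p s e with ends (c ∷ p) s (cong (c ∷_) e)
    ... | inj₂ s≡[] = s≡[]

border⇒closed : IsPrefix x W → IsSuffix x W → length x < length W → occ x W ≡ 2 → Closed W
border⇒closed {[]}    {W} _   _   _ twice = inj₁ (suc-injective (trans (sym (occ-[] W)) twice))
border⇒closed {c ∷ x}     pre suf lt twice = inj₂ (c ∷ x , (λ ()) , lt , twice , pre , suf)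

-- In an open word, a proper factor occurring only at the ends of the word is unrepeated:
-- occurring at both ends would make it a border occurring twice.
open⇒ends-unrepeated : Open W → x ⊑ W → length x < length W → OnlyAtEnds x W → Unrepeated x W
open⇒ends-unrepeated {W} {x} open-W f lt ends with isPrefix? x W | isSuffix? x W
... | yes pre | yes suf =
  ⊥-elim (open-W (border⇒closed pre suf lt (border-occurs-twice pre suf lt ends)))
... | yes _   | no ¬suf = prefix-occurrences⇒unrepeated f prefix-only
  where
    prefix-only : ∀ p s → p ++ x ++ s ≡ W → p ≡ []
    prefix-only p s e with ends p s e
    ... | inj₁ p≡[] = p≡[]
    ... | inj₂ refl = ⊥-elim (¬suf (occurrence⇒suffix p e))
... | no ¬pre | yes _   = suffix-occurrences⇒unrepeated x f suffix-only
  where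
    suffix-only : ∀ p s → p ++ x ++ s ≡ W → s ≡ []
    suffix-only p s e with ends p s e
    ... | inj₁ refl = ⊥-elim (¬pre (s , e))
    ... | inj₂ s≡[] = s≡[]
... | no ¬pre | no ¬suf = ⊥-elim (at-an-end f)
  where
    at-an-end : x ⊑ W → ⊥
    at-an-end (p , s , e) with ends p s e
    ... | inj₁ refl = ¬pre (s , e)
    ... | inj₂ refl = ¬suf (occurrence⇒suffix p e)

factor-length : x ⊑ W → length x ≤ length W
factor-length {x} (p , s , e) = subst (length x ≤_) (occurrence-length p x s e)
  (≤-trans (m≤n+m (length x) (length p)) (m≤m+n (length p + length x) (length s)))

length-snoc : ∀ (x : Word) c → length (x ++ c ∷ []) ≡ suc (length x)
length-snoc x c = trans (length-++ x) (+-comm (length x) 1)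

LeftExtendable : Word → Word → Set
LeftExtendable x W = ∃ λ c → (c ∷ x) ⊑ W

RightExtendable : Word → Word → Set
RightExtendable x W = ∃ λ c → (x ++ c ∷ []) ⊑ W

LeftSpecial : Word → Word → Set
LeftSpecial x W = (a ∷ x) ⊑ W × (b ∷ x) ⊑ W

RightSpecial : Word → Word → Set
RightSpecial x W = (x ++ a ∷ []) ⊑ W × (x ++ b ∷ []) ⊑ W

leftSpecial-by : ∀ c → (c ∷ x) ⊑ W → (other c ∷ x) ⊑ W → LeftSpecial x W
leftSpecial-by a fa fb = fa , fb
leftSpecial-by b fb fa = fa , fb

rightSpecial-by : ∀ c → (x ++ c ∷ []) ⊑ W → (x ++ other c ∷ []) ⊑ W → RightSpecial x W
rightSpecial-by a fa fb = fa , fb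
rightSpecial-by b fb fa = fa , fb

leftSpecial-extension : ∀ c → LeftSpecial x W → (c ∷ x) ⊑ W
leftSpecial-extension a (fa , _) = fa
leftSpecial-extension b (_ , fb) = fb

leftSpecial-take : ∀ m → LeftSpecial x W → LeftSpecial (take m x) W
leftSpecial-take {x} m (fa , fb) = factor-take (suc m) (a ∷ x) fa , factor-take (suc m) (b ∷ x) fb

someLetter? : {P : Letter → Set} → (∀ c → Dec (P c)) → Dec (∃ P)
someLetter? P? with P? a | P? b
... | yes pa  | _       = yes (a , pa)
... | no _    | yes pb  = yes (b , pb)
... | no ¬pa  | no ¬pb  = no λ { (a , pa) → ¬pa pa ; (b , pb) → ¬pb pb }

leftExtendable? : ∀ x W → Dec (LeftExtendable x W)
leftExtendable? x W = someLetter? λ c → (c ∷ x) ⊑? W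

rightExtendable? : ∀ x W → Dec (RightExtendable x W)
rightExtendable? x W = someLetter? λ c → (x ++ c ∷ []) ⊑? W

preceding-letter : ∀ c p x s → (c ∷ p) ++ x ++ s ≡ W → ∃₂ λ e q → q ++ (e ∷ x) ++ s ≡ W
preceding-letter c []      x s e    = c , [] , e
preceding-letter c (d ∷ p) x s refl with preceding-letter d p x s refl
... | e , q , eq = e , c ∷ q , cong (c ∷_) eq

¬leftExtendable⇒prefix-occurrences : ¬ LeftExtendable x W → ∀ p s → p ++ x ++ s ≡ W → p ≡ []
¬leftExtendable⇒prefix-occurrences ¬ext []      s e = refl
¬leftExtendable⇒prefix-occurrences {x} ¬ext (c ∷ p) s e with preceding-letter c p x s e
... | e′ , q , eq = ⊥-elim (¬ext (e′ , q , s , eq))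

¬rightExtendable⇒suffix-occurrences : ¬ RightExtendable x W → ∀ p s → p ++ x ++ s ≡ W → s ≡ []
¬rightExtendable⇒suffix-occurrences ¬ext p []      e = refl
¬rightExtendable⇒suffix-occurrences {x} ¬ext p (c ∷ s) e =
  ⊥-elim (¬ext (c , p , s , trans (cong (p ++_) (++-assoc x (c ∷ []) s)) e))

unrepeated-prefix⇒¬leftExtendable : Unrepeated x W → IsPrefix x W → ¬ LeftExtendable x W
unrepeated-prefix⇒¬leftExtendable {x} once pre (c , p , s , e) =
  snoc≢[] (unrepeated-prefix-occurrence once pre (p ++ c ∷ []) s
                                         (trans (++-assoc p (c ∷ []) (x ++ s)) e))
  where
    snoc≢[] : p ++ c ∷ [] ≢ []
    snoc≢[] eq with ++-conicalʳ p (c ∷ []) eq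
    ... | ()

unrepeated-suffix⇒¬rightExtendable : Unrepeated x W → IsSuffix x W → ¬ RightExtendable x W
unrepeated-suffix⇒¬rightExtendable {x} once suf (c , p , s , e) with
  unrepeated-suffix-occurrence once suf p (c ∷ s) (trans (cong (p ++_) (sym (++-assoc x (c ∷ []) s))) e)
... | ()

-- If dS is an unrepeated suffix of an open word, then S is left special or unrepeated:
-- when only d precedes S, every occurrence of S is inside that of dS or at the start.
unrepeated-suffix-tail : ∀ {d S} → Open W → Unrepeated (d ∷ S) W → IsSuffix (d ∷ S) W →
                         LeftSpecial S W ⊎ Unrepeated S W
unrepeated-suffix-tail {W} {d} {S} open-W once suf with (other d ∷ S) ⊑? W
... | yes f-other = inj₁ (leftSpecial-by d (suffix⇒factor suf) f-other)
... | no ¬f-other = inj₂ (open⇒ends-unrepeated open-W (factor-++ʳ (d ∷ []) S (suffix⇒factor suf))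
                                                   (factor-length (suffix⇒factor suf)) ends)
  where
    ends : OnlyAtEnds S W
    ends []      s e = inj₁ refl
    ends (c ∷ p) s e with preceding-letter c p S s e
    ... | e′ , q , eq with e′ ≟ᴸ d
    ...   | yes refl = inj₂ (unrepeated-suffix-occurrence {x = d ∷ S} once suf q s eq)
    ...   | no e′≢d  =
      ⊥-elim (¬f-other (q , s , subst (λ l → q ++ (l ∷ S) ++ s ≡ W) (≢⇒other e′≢d) eq))

unrepeated-prefix-init : ∀ {P c} → Open W → Unrepeated (P ++ c ∷ []) W → IsPrefix (P ++ c ∷ []) W →
                         RightSpecial P W ⊎ Unrepeated P W
unrepeated-prefix-init {W} {P} {c} open-W once pre with (P ++ other c ∷ []) ⊑? W
... | yes f-other = inj₁ (rightSpecial-by c (prefix⇒factor pre) f-other)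
... | no ¬f-other = inj₂ (open⇒ends-unrepeated open-W (factor-++ˡ P (c ∷ []) f-Pc)
                            (subst (_≤ length W) (length-snoc P c) (factor-length f-Pc)) ends)
  where
    f-Pc : (P ++ c ∷ []) ⊑ W
    f-Pc = prefix⇒factor pre
    ends : OnlyAtEnds P W
    ends p []       e = inj₂ refl
    ends p (e′ ∷ s) e with e′ ≟ᴸ c
    ... | yes refl = inj₁ (unrepeated-prefix-occurrence {x = P ++ c ∷ []} once pre p s
                             (trans (cong (p ++_) (++-assoc P (c ∷ []) s)) e))
    ... | no e′≢c  = ⊥-elim (¬f-other (p , s , trans (cong (p ++_) (++-assoc P (other c ∷ []) s))
                                         (subst (λ l → p ++ P ++ l ∷ s ≡ W) (≢⇒other e′≢c) e)))

take-isPrefix : ∀ i (W : Word) → IsPrefix (take i W) W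
take-isPrefix i W = drop i W , take++drop≡id i W

take-length-++ : ∀ (x : Word) {s} → take (length x) (x ++ s) ≡ x
take-length-++ []      = refl
take-length-++ (c ∷ x) = cong (c ∷_) (take-length-++ x)

length-take≤ : ∀ {i} (W : Word) → i ≤ length W → length (take i W) ≡ i
length-take≤ {i} W i≤|W| = trans (length-take i W) (m≤n⇒m⊓n≡m i≤|W|)

take-snoc : ∀ {i} (W : Word) → i < length W → ∃ λ c → take (suc i) W ≡ take i W ++ c ∷ []
take-snoc {zero}  (c ∷ W) _       = c , refl
take-snoc {suc i} (d ∷ W) (s≤s i<|W|) with take-snoc W i<|W|
... | c , eq = c , cong (d ∷_) eq

suffixOf-suc : ∀ {j} (W : Word) → suc j ≤ length W →
               ∃ λ d → suffixOf (suc j) W ≡ d ∷ suffixOf j W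
suffixOf-suc {j} W sj≤|W| with drop (length W ∸ suc j) W in eq
... | []    = ⊥-elim (1+n≢0 (trans (sym (suffixOf-length W sj≤|W|)) (cong length eq)))
... | d ∷ r = d , cong (d ∷_) (begin
      r                                ≡⟨ sym (drop-next (length W ∸ suc j) W eq) ⟩
      drop (suc (length W ∸ suc j)) W  ≡⟨ cong (λ m → drop m W) (sym (+-∸-assoc 1 sj≤|W|)) ⟩
      drop (length W ∸ j) W            ∎)
  where
    open ≡-Reasoning
    drop-next : ∀ {d r} m (W : Word) → drop m W ≡ d ∷ r → drop (suc m) W ≡ r
    drop-next zero    (_ ∷ W) refl = refl
    drop-next (suc m) (_ ∷ W) eq   = drop-next m W eq

-- The left profile of W at h: the prefixes of W shorter than h are left extendable,
-- the prefix of length h is not.  The counting argument below only needs this profile.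
LeftProfile : Word → ℕ → Set
LeftProfile W h = h ≤ length W × (∀ i → i < h → LeftExtendable (take i W) W)
                × ¬ LeftExtendable (take h W) W

RightProfile : Word → ℕ → Set
RightProfile W k = k ≤ length W × (∀ i → i < k → RightExtendable (suffixOf i W) W)
                 × ¬ RightExtendable (suffixOf k W) W

-- H_w determines the left profile: a prefix without left extension occurs only as a prefix.
IsH⇒LeftProfile : ∀ {h} → IsH W h → LeftProfile W h
IsH⇒LeftProfile {W} {h} (h≤|W| , once , shortest) =
  h≤|W| , extendable , unrepeated-prefix⇒¬leftExtendable once (take-isPrefix h W)
  where
    extendable : ∀ i → i < h → LeftExtendable (take i W) W
    extendable i i<h with leftExtendable? (take i W) W
    ... | yes ext  = ext
    ... | no ¬ext = ⊥-elim (shortest i i<h (prefix-occurrences⇒unrepeated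
                      (prefix⇒factor (take-isPrefix i W)) (¬leftExtendable⇒prefix-occurrences ¬ext)))

IsK⇒RightProfile : ∀ {k} → IsK W k → RightProfile W k
IsK⇒RightProfile {W} {k} (k≤|W| , once , shortest) =
  k≤|W| , extendable , unrepeated-suffix⇒¬rightExtendable once (suffixOf-isSuffix k W)
  where
    extendable : ∀ i → i < k → RightExtendable (suffixOf i W) W
    extendable i i<k with rightExtendable? (suffixOf i W) W
    ... | yes ext  = ext
    ... | no ¬ext = ⊥-elim (shortest i i<k (suffix-occurrences⇒unrepeated (suffixOf i W)
                      (suffix⇒factor (suffixOf-isSuffix i W))
                      (¬rightExtendable⇒suffix-occurrences ¬ext)))

-- In an open word, the suffix one letter shorter than the shortest unrepeated suffix is
-- left special, and the prefix one letter shorter than the shortest unrepeated prefix is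
-- right special (being shorter, they are repeated).
open⇒leftSpecial-suffix : ∀ {j} → Open W → IsK W (suc j) → LeftSpecial (suffixOf j W) W
open⇒leftSpecial-suffix {W} {j} open-W (sj≤|W| , once , shortest) with suffixOf-suc W sj≤|W|
... | d , v≡dS with unrepeated-suffix-tail open-W (subst (λ v → Unrepeated v W) v≡dS once)
                      (subst (λ v → IsSuffix v W) v≡dS (suffixOf-isSuffix (suc j) W))
...   | inj₁ special    = special
...   | inj₂ unrepeated = ⊥-elim (shortest j (n<1+n j) unrepeated)

open⇒rightSpecial-prefix : ∀ {i} → Open W → IsH W (suc i) → RightSpecial (take i W) W
open⇒rightSpecial-prefix {W} {i} open-W (si≤|W| , once , shortest) with take-snoc W si≤|W|
... | c , u≡Pc with unrepeated-prefix-init {P = take i W} open-W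
                      (subst (λ u → Unrepeated u W) u≡Pc once)
                      (subst (λ u → IsPrefix u W) u≡Pc (take-isPrefix (suc i) W))
...   | inj₁ special    = special
...   | inj₂ unrepeated = ⊥-elim (shortest i (n<1+n i) unrepeated)

factor-reverse : x ⊑ W → reverse x ⊑ reverse W
factor-reverse {x} {W} (p , s , e) = reverse s , reverse p , (begin
  reverse s ++ reverse x ++ reverse p  ≡⟨ cong (reverse s ++_) (sym (reverse-++ p x)) ⟩
  reverse s ++ reverse (p ++ x)        ≡⟨ sym (reverse-++ (p ++ x) s) ⟩
  reverse ((p ++ x) ++ s)              ≡⟨ cong reverse (++-assoc p x s) ⟩
  reverse (p ++ x ++ s)                ≡⟨ cong reverse e ⟩
  reverse W                            ∎)
  where open ≡-Reasoning

factor-reverse⁻ : x ⊑ reverse W → reverse x ⊑ W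
factor-reverse⁻ {x} {W} f = subst (reverse x ⊑_) (reverse-involutive W) (factor-reverse f)

factor-unreverse : reverse x ⊑ reverse W → x ⊑ W
factor-unreverse {x} f = subst (_⊑ _) (reverse-involutive x) (factor-reverse⁻ f)

reverse-snoc : ∀ (x : Word) c → reverse (x ++ c ∷ []) ≡ c ∷ reverse x
reverse-snoc x c = reverse-++ x (c ∷ [])

rightExtendable-reverse : RightExtendable x W → LeftExtendable (reverse x) (reverse W)
rightExtendable-reverse {x} (c , f) = c , subst (_⊑ _) (reverse-snoc x c) (factor-reverse f)

leftExtendable-unreverse : LeftExtendable (reverse x) (reverse W) → RightExtendable x W
leftExtendable-unreverse {x} (c , f) = c , factor-unreverse (subst (_⊑ _) (sym (reverse-snoc x c)) f)

rightExtendable-unreverse : RightExtendable (reverse x) (reverse W) → LeftExtendable x W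
rightExtendable-unreverse {x} (c , f) = c , factor-unreverse (subst (_⊑ _) (sym (unfold-reverse c x)) f)

rightSpecial-reverse : RightSpecial x W → LeftSpecial (reverse x) (reverse W)
rightSpecial-reverse {x} (fa , fb) =
  subst (_⊑ _) (reverse-snoc x a) (factor-reverse fa) ,
  subst (_⊑ _) (reverse-snoc x b) (factor-reverse fb)

take-reverse : ∀ {i} (W : Word) → i ≤ length W → take i (reverse W) ≡ reverse (suffixOf i W)
take-reverse {i} W i≤|W| = begin
  take i (reverse W)                    ≡⟨ cong (take i ∘ reverse) (sym (take++drop≡id m W)) ⟩
  take i (reverse (take m W ++ v))      ≡⟨ cong (take i) (reverse-++ (take m W) v) ⟩
  take i (reverse v ++ u)               ≡⟨ cong (λ l → take l (reverse v ++ u)) (sym |reverse-v|) ⟩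
  take (length (reverse v)) (reverse v ++ u) ≡⟨ take-length-++ (reverse v) ⟩
  reverse v                             ∎
  where
    open ≡-Reasoning
    m : ℕ
    m = length W ∸ i
    v u : Word
    v = suffixOf i W
    u = reverse (take m W)
    |reverse-v| : length (reverse v) ≡ i
    |reverse-v| = trans (length-reverse v) (suffixOf-length W i≤|W|)

RightProfile⇒LeftProfile-reverse : ∀ {k} → RightProfile W k → LeftProfile (reverse W) k
RightProfile⇒LeftProfile-reverse {W} {k} (k≤|W| , extendable , ¬extendable) =
  subst (k ≤_) (sym (length-reverse W)) k≤|W| ,
  (λ i i<k → subst (λ v → LeftExtendable v (reverse W))
                    (sym (take-reverse W (≤-trans (<⇒≤ i<k) k≤|W|)))
                    (rightExtendable-reverse (extendable i i<k))) ,
  λ ext → ¬extendable (leftExtendable-unreverse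
            (subst (λ v → LeftExtendable v (reverse W)) (take-reverse W k≤|W|) ext))

LowComplexity : Word → Set
LowComplexity W = ∀ m (G : List Word) → Unique G → (∀ {y} → y ∈ G → length y ≡ m × y ⊑ W) →
                  length G ≤ suc m

lowComplexity-reverse : LowComplexity W → LowComplexity (reverse W)
lowComplexity-reverse {W} low m G unique factors =
  subst (_≤ suc m) (length-map reverse G)
        (low m (map reverse G) (map⁺ reverse-injective unique) reversed)
  where
    reversed : ∀ {y} → y ∈ map reverse G → length y ≡ m × y ⊑ W
    reversed y∈ with ∈-map⁻ reverse y∈
    ... | y , y∈G , refl =
      trans (length-reverse y) (proj₁ (factors y∈G)) , factor-reverse⁻ (proj₂ (factors y∈G))

unique-⊆-length : ∀ {G L : List Word} → Unique G → (∀ {y} → y ∈ G → y ∈ L) →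
                  length G ≤ length L
unique-⊆-length {[]}    _                  _  = z≤n
unique-⊆-length {y ∷ G} {L} (y∉G AP.∷ unique) G⊆L with ∈-∃++ (G⊆L (here refl))
... | L₁ , L₂ , refl = begin
  suc (length G)              ≤⟨ s≤s (unique-⊆-length unique G⊆L₁L₂) ⟩
  suc (length (L₁ ++ L₂))     ≡⟨ cong suc (length-++ L₁) ⟩
  suc (length L₁ + length L₂) ≡⟨ sym (+-suc (length L₁) (length L₂)) ⟩
  length L₁ + suc (length L₂) ≡⟨ sym (length-++ L₁) ⟩
  length (L₁ ++ y ∷ L₂)       ∎
  where
    open ≤-Reasoning
    G⊆L₁L₂ : ∀ {z} → z ∈ G → z ∈ L₁ ++ L₂
    G⊆L₁L₂ z∈G with ∈-++⁻ L₁ (G⊆L (there z∈G))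
    ... | inj₁ z∈L₁         = ∈-++⁺ˡ z∈L₁
    ... | inj₂ (here refl)  = ⊥-elim (All.lookup y∉G z∈G refl)
    ... | inj₂ (there z∈L₂) = ∈-++⁺ʳ L₁ z∈L₂

factorAt-suc : ∀ (x : InfWord) i m → factorAt x i (suc m) ≡ x i ∷ factorAt x (suc i) m
factorAt-suc x i m = cong₂ _∷_ (cong x (+-identityʳ i)) (begin
  map (λ j → x (i + j)) (applyUpTo suc m)    ≡⟨ cong (map _) (sym (map-upTo suc m)) ⟩
  map (λ j → x (i + j)) (map suc (upTo m))   ≡⟨ sym (map-∘ (upTo m)) ⟩
  map (λ j → x (i + suc j)) (upTo m)         ≡⟨ map-cong (λ j → cong x (+-suc i j)) (upTo m) ⟩
  map (λ j → x (suc i + j)) (upTo m)         ∎)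
  where open ≡-Reasoning

factorAt-prefix : ∀ x i (y s : Word) N → y ++ s ≡ factorAt x i N → factorAt x i (length y) ≡ y
factorAt-prefix x i []      s N       e = refl
factorAt-prefix x i (c ∷ y) s (suc N) e with ∷-injective (trans e (factorAt-suc x i N))
... | c≡ , rest =
  trans (factorAt-suc x i (length y)) (cong₂ _∷_ (sym c≡) (factorAt-prefix x (suc i) y s N rest))

factorAt-factor : ∀ x i (p y s : Word) N → p ++ y ++ s ≡ factorAt x i N →
                  factorAt x (i + length p) (length y) ≡ y
factorAt-factor x i []      y s N       e =
  trans (cong (λ j → factorAt x j (length y)) (+-identityʳ i)) (factorAt-prefix x i y s N e)
factorAt-factor x i (c ∷ p) y s (suc N) e =
  trans (cong (λ j → factorAt x j (length y)) (+-suc i (length p)))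
        (factorAt-factor x (suc i) p y s N (∷-injectiveʳ (trans e (factorAt-suc x i N))))

-- A factor of a Sturmian infinite word has low complexity: its distinct factors of length m
-- are among the m + 1 factors of that length of the infinite word.
sturmian⇒lowComplexity : Sturmian W → LowComplexity W
sturmian⇒lowComplexity {W} (x , sturmian-x , i₀ , read-W) m G unique factors with sturmian-x m
... | L , |L|≡ , _ , L-factors = subst (length G ≤_) |L|≡ (unique-⊆-length unique G⊆L)
  where
    G⊆L : ∀ {y} → y ∈ G → y ∈ L
    G⊆L {y} y∈G with factors y∈G
    ... | |y|≡m , p , s , e = Equivalence.from (L-factors y) (i₀ + length p , (begin
      factorAt x (i₀ + length p) m            ≡⟨ cong (factorAt x (i₀ + length p)) (sym |y|≡m) ⟩
      factorAt x (i₀ + length p) (length y)   ≡⟨ factorAt-factor x i₀ p y s _ (trans e (sym read-W)) ⟩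
      y                                       ∎))
      where open ≡-Reasoning

full-length-factor : x ⊑ W → length x ≡ length W → x ≡ W
full-length-factor {x} {W} (p , s , e) |x|≡|W|
  with length≡0⇒[] {p} (m+n≡0⇒m≡0 (length p) |p|+|s|≡0)
     | length≡0⇒[] {s} (m+n≡0⇒n≡0 (length p) |p|+|s|≡0)
  where
    |p|+|s|≡0 : length p + length s ≡ 0
    |p|+|s|≡0 = +-cancelˡ-≡ (length x) (length p + length s) 0 (begin
      length x + (length p + length s)  ≡⟨ x∙yz≈y∙xz (length x) (length p) (length s) ⟩
      length p + (length x + length s)  ≡⟨ sym (+-assoc (length p) (length x) (length s)) ⟩
      length p + length x + length s    ≡⟨ occurrence-length p x s e ⟩
      length W                          ≡⟨ sym |x|≡|W| ⟩
      length x                          ≡⟨ sym (+-identityʳ (length x)) ⟩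
      length x + 0                      ∎)
      where open ≡-Reasoning
... | refl | refl = trans (sym (++-identityʳ x)) e

ι : Bool → ℕ
ι true  = 1
ι false = 0

¬≢0⇒≡0 : ∀ n → ¬ n ≢ 0 → n ≡ 0
¬≢0⇒≡0 zero    _   = refl
¬≢0⇒≡0 (suc n) ¬≢0 = ⊥-elim (¬≢0 λ ())

module _ (f : Word → ℕ) where

  sum-≥1 : ∀ {xs x} → x ∈ xs → f x ≡ 1 → 1 ≤ sum (map f xs)
  sum-≥1 {y ∷ ys} (here refl) fx≡1 = subst (λ m → 1 ≤ m + sum (map f ys)) (sym fx≡1) (s≤s z≤n)
  sum-≥1 {y ∷ ys} (there x∈)  fx≡1 = ≤-trans (sum-≥1 x∈ fx≡1) (m≤n+m _ (f y))

  sum-≥2 : ∀ {xs x y} → x ∈ xs → y ∈ xs → x ≢ y → f x ≡ 1 → f y ≡ 1 → 2 ≤ sum (map f xs)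
  sum-≥2 (here refl) (here refl) x≢y _ _ = ⊥-elim (x≢y refl)
  sum-≥2 {z ∷ zs} (here refl) (there y∈) _ fx≡1 fy≡1 =
    subst (λ m → 2 ≤ m + sum (map f zs)) (sym fx≡1) (s≤s (sum-≥1 y∈ fy≡1))
  sum-≥2 {z ∷ zs} (there x∈) (here refl) _ fx≡1 fy≡1 =
    subst (λ m → 2 ≤ m + sum (map f zs)) (sym fy≡1) (s≤s (sum-≥1 x∈ fx≡1))
  sum-≥2 {z ∷ zs} (there x∈) (there y∈) x≢y fx≡1 fy≡1 =
    ≤-trans (sum-≥2 x∈ y∈ x≢y fx≡1 fy≡1) (m≤n+m _ (f z))

  sum-≡0 : ∀ xs → (∀ {x} → x ∈ xs → f x ≡ 0) → sum (map f xs) ≡ 0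
  sum-≡0 []       _      = refl
  sum-≡0 (y ∷ ys) vanish = cong₂ _+_ (vanish (here refl)) (sum-≡0 ys (vanish ∘ there))

  sum-≡1 : ∀ xs {z} → Unique xs → z ∈ xs → f z ≡ 1 → (∀ {x} → x ∈ xs → f x ≢ 0 → x ≡ z) →
           sum (map f xs) ≡ 1
  sum-≡1 (y ∷ ys) (y∉ys AP.∷ _) (here refl) fz≡1 only-z =
    cong₂ _+_ fz≡1 (sum-≡0 ys λ {x} x∈ys →
      ¬≢0⇒≡0 (f x) λ fx≢0 → All.lookup y∉ys x∈ys (sym (only-z (there x∈ys) fx≢0)))
  sum-≡1 (y ∷ ys) (y∉ys AP.∷ unique) (there z∈ys) fz≡1 only-z with f y ≟ 0
  ... | yes fy≡0 = cong₂ _+_ fy≡0 (sum-≡1 ys unique z∈ys fz≡1 (only-z ∘ there))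
  ... | no fy≢0  = ⊥-elim (All.lookup y∉ys z∈ys (only-z (here refl) fy≢0))

unique-constant-length : ∀ {xs : List Word} {z} → Unique xs → z ∈ xs → (∀ {x} → x ∈ xs → x ≡ z) →
                         length xs ≡ 1
unique-constant-length {_ ∷ []}    _                 _ _      = refl
unique-constant-length {_ ∷ _ ∷ _} (y∉ AP.∷ _) _ only-z =
  ⊥-elim (All.lookup y∉ (here refl) (trans (only-z (here refl)) (sym (only-z (there (here refl))))))

Σ< : (ℕ → ℕ) → ℕ → ℕ
Σ< f zero    = 0
Σ< f (suc i) = Σ< f i + f i

Σ<-≥ : ∀ f i → (∀ j → j < i → 1 ≤ f j) → i ≤ Σ< f i
Σ<-≥ f zero    _        = z≤n
Σ<-≥ f (suc i) positive = subst (_≤ Σ< f i + f i) (+-comm i 1)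
  (+-mono-≤ (Σ<-≥ f i (λ j j<i → positive j (m<n⇒m<1+n j<i))) (positive i (n<1+n i)))

Σ<-mono : ∀ f {i j} → i ≤ j → Σ< f i ≤ Σ< f j
Σ<-mono f {j = zero}  z≤n  = ≤-refl
Σ<-mono f {j = suc j} i≤sj with m≤n⇒m<n∨m≡n i≤sj
... | inj₁ (s≤s i≤j) = ≤-trans (Σ<-mono f i≤j) (m≤m+n (Σ< f j) (f j))
... | inj₂ refl      = ≤-refl

Σ<-stable : ∀ f {k} → (∀ j → k ≤ j → f j ≡ 0) → ∀ {i} → k ≤ i → Σ< f i ≡ Σ< f k
Σ<-stable f vanish {zero}  z≤n = refl
Σ<-stable f {k} vanish {suc i} k≤si with m≤n⇒m<n∨m≡n k≤si
... | inj₁ (s≤s k≤i) = trans (cong₂ _+_ (Σ<-stable f vanish k≤i) (vanish i k≤i)) (+-identityʳ (Σ< f k))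
... | inj₂ refl      = refl

-- The factors of W listed length by length, each list obtained from the previous one by
-- left extension, together with the numbers of left special factors and of factors without
-- left extension (dead ends) of each length.
module FactorCounting (W : Word) where

  extensions : ∀ {x} → Dec ((a ∷ x) ⊑ W) → Dec ((b ∷ x) ⊑ W) → List Word
  extensions {x} (yes _) (yes _) = (a ∷ x) ∷ (b ∷ x) ∷ []
  extensions {x} (yes _) (no _)  = (a ∷ x) ∷ []
  extensions {x} (no _)  (yes _) = (b ∷ x) ∷ []
  extensions     (no _)  (no _)  = []

  both neither : ∀ {A B : Set} → Dec A → Dec B → ℕ
  both    da db = ι (does da ∧ does db)
  neither da db = ι (not (does da) ∧ not (does db))

  extensions-count : ∀ {x} da db → length (extensions {x} da db) + neither da db ≡ 1 + both da db
  extensions-count (yes _) (yes _) = refl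
  extensions-count (yes _) (no _)  = refl
  extensions-count (no _)  (yes _) = refl
  extensions-count (no _)  (no _)  = refl

  extensions-sound : ∀ {x y} da db → y ∈ extensions {x} da db → ∃ λ c → y ≡ c ∷ x × y ⊑ W
  extensions-sound (yes fa) (yes _)  (here refl)         = a , refl , fa
  extensions-sound (yes _)  (yes fb) (there (here refl)) = b , refl , fb
  extensions-sound (yes fa) (no _)   (here refl)         = a , refl , fa
  extensions-sound (no _)   (yes fb) (here refl)         = b , refl , fb

  extensions-complete : ∀ {x} c da db → (c ∷ x) ⊑ W → (c ∷ x) ∈ extensions {x} da db
  extensions-complete a (yes _)  (yes _)  _  = here refl
  extensions-complete a (yes _)  (no _)   _  = here refl
  extensions-complete a (no ¬fa) _        fa = ⊥-elim (¬fa fa)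
  extensions-complete b (yes _)  (yes _)  _  = there (here refl)
  extensions-complete b (no _)   (yes _)  _  = here refl
  extensions-complete b _        (no ¬fb) fb = ⊥-elim (¬fb fb)

  extensions-unique : ∀ {x} da db → Unique (extensions {x} da db)
  extensions-unique (yes _) (yes _) = ((λ ()) All.∷ All.[]) AP.∷ All.[] AP.∷ AP.[]
  extensions-unique (yes _) (no _)  = All.[] AP.∷ AP.[]
  extensions-unique (no _)  (yes _) = All.[] AP.∷ AP.[]
  extensions-unique (no _)  (no _)  = AP.[]

  both-≡1 : ∀ {A B : Set} (da : Dec A) (db : Dec B) → A → B → both da db ≡ 1
  both-≡1 (yes _) (yes _) _ _ = refl
  both-≡1 (no ¬A) _       α _ = ⊥-elim (¬A α)
  both-≡1 (yes _) (no ¬B) _ β = ⊥-elim (¬B β)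

  both-≢0 : ∀ {A B : Set} (da : Dec A) (db : Dec B) → both da db ≢ 0 → A × B
  both-≢0 (yes α) (yes β) _  = α , β
  both-≢0 (yes _) (no _)  ≢0 = ⊥-elim (≢0 refl)
  both-≢0 (no _)  _       ≢0 = ⊥-elim (≢0 refl)

  neither-≡0 : ∀ {A B : Set} (da : Dec A) (db : Dec B) → A ⊎ B → neither da db ≡ 0
  neither-≡0 (yes _) _        _        = refl
  neither-≡0 (no _)  (yes _)  _        = refl
  neither-≡0 (no ¬A) (no _)   (inj₁ α) = ⊥-elim (¬A α)
  neither-≡0 (no _)  (no ¬B)  (inj₂ β) = ⊥-elim (¬B β)

  neither-≡1 : ∀ {A B : Set} (da : Dec A) (db : Dec B) → ¬ A → ¬ B → neither da db ≡ 1
  neither-≡1 (no _)  (no _)  _  _  = refl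
  neither-≡1 (yes α) _       ¬A _  = ⊥-elim (¬A α)
  neither-≡1 (no _)  (yes β) _  ¬B = ⊥-elim (¬B β)

  leftExtensions : Word → List Word
  leftExtensions x = extensions ((a ∷ x) ⊑? W) ((b ∷ x) ⊑? W)

  special deadEnd : Word → ℕ
  special x = both    ((a ∷ x) ⊑? W) ((b ∷ x) ⊑? W)
  deadEnd x = neither ((a ∷ x) ⊑? W) ((b ∷ x) ⊑? W)

  deadEnd-≡0 : LeftExtendable x W → deadEnd x ≡ 0
  deadEnd-≡0 {x} (a , fa) = neither-≡0 ((a ∷ x) ⊑? W) ((b ∷ x) ⊑? W) (inj₁ fa)
  deadEnd-≡0 {x} (b , fb) = neither-≡0 ((a ∷ x) ⊑? W) ((b ∷ x) ⊑? W) (inj₂ fb)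

  deadEnd-≡1 : ¬ LeftExtendable x W → deadEnd x ≡ 1
  deadEnd-≡1 {x} ¬ext = neither-≡1 ((a ∷ x) ⊑? W) ((b ∷ x) ⊑? W) (¬ext ∘ (a ,_)) (¬ext ∘ (b ,_))

  deadEnd-≢0 : deadEnd x ≢ 0 → ¬ LeftExtendable x W
  deadEnd-≢0 {x} ≢0 (c , f) = ≢0 (deadEnd-≡0 (c , f))

  Factors : ℕ → List Word
  Factors zero    = [] ∷ []
  Factors (suc i) = concatMap leftExtensions (Factors i)

  concatMap-∈⁻ : ∀ {y} xs → y ∈ concatMap leftExtensions xs → ∃ λ x → x ∈ xs × y ∈ leftExtensions x
  concatMap-∈⁻ (x ∷ xs) y∈ with ∈-++⁻ (leftExtensions x) y∈
  ... | inj₁ y∈x  = x , here refl , y∈x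
  ... | inj₂ y∈xs with concatMap-∈⁻ xs y∈xs
  ...   | x′ , x′∈ , y∈x′ = x′ , there x′∈ , y∈x′

  concatMap-∈⁺ : ∀ {x y} xs → x ∈ xs → y ∈ leftExtensions x → y ∈ concatMap leftExtensions xs
  concatMap-∈⁺ (x ∷ xs) (here refl) y∈ = ∈-++⁺ˡ y∈
  concatMap-∈⁺ (x ∷ xs) (there x∈)  y∈ = ∈-++⁺ʳ (leftExtensions x) (concatMap-∈⁺ xs x∈ y∈)

  concatMap-unique : ∀ xs → Unique xs → Unique (concatMap leftExtensions xs)
  concatMap-unique []       _                 = AP.[]
  concatMap-unique (x ∷ xs) (x∉xs AP.∷ unique) =
    ++⁺ (extensions-unique ((a ∷ x) ⊑? W) ((b ∷ x) ⊑? W)) (concatMap-unique xs unique) disjoint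
    where
      disjoint : ∀ {v} → ¬ (v ∈ leftExtensions x × v ∈ concatMap leftExtensions xs)
      disjoint (v∈x , v∈xs)
        with extensions-sound ((a ∷ x) ⊑? W) ((b ∷ x) ⊑? W) v∈x | concatMap-∈⁻ xs v∈xs
      ... | c , refl , _ | x′ , x′∈xs , v∈x′ with extensions-sound ((a ∷ x′) ⊑? W) ((b ∷ x′) ⊑? W) v∈x′
      ...   | _ , refl , _ = All.lookup x∉xs x′∈xs refl

  Factors-sound : ∀ i {y} → y ∈ Factors i → length y ≡ i × y ⊑ W
  Factors-sound zero    (here refl) = refl , [] , W , refl
  Factors-sound (suc i) y∈ with concatMap-∈⁻ (Factors i) y∈
  ... | x , x∈ , y∈x with extensions-sound ((a ∷ x) ⊑? W) ((b ∷ x) ⊑? W) y∈x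
  ...   | c , refl , f = cong suc (proj₁ (Factors-sound i x∈)) , f

  Factors-unique : ∀ i → Unique (Factors i)
  Factors-unique zero    = All.[] AP.∷ AP.[]
  Factors-unique (suc i) = concatMap-unique (Factors i) (Factors-unique i)

  Factors-complete : ∀ i {y} → length y ≡ i → y ⊑ W → y ∈ Factors i
  Factors-complete zero    {[]}    _    _ = here refl
  Factors-complete (suc i) {c ∷ y} refl f =
    concatMap-∈⁺ (Factors i) (Factors-complete i refl (factor-++ʳ (c ∷ []) y f))
                 (extensions-complete c ((a ∷ y) ⊑? W) ((b ∷ y) ⊑? W) f)

  complexity specialCount deadEndCount : ℕ → ℕ
  complexity   i = length (Factors i)
  specialCount i = sum (map special (Factors i))
  deadEndCount i = sum (map deadEnd (Factors i))

  -- Counting the factors of length i + 1 by their suffix of length i.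
  extension-recurrence : ∀ i → complexity (suc i) + deadEndCount i ≡ complexity i + specialCount i
  extension-recurrence i = over (Factors i)
    where
      open ≡-Reasoning
      over : ∀ xs → length (concatMap leftExtensions xs) + sum (map deadEnd xs)
                  ≡ length xs + sum (map special xs)
      over []       = refl
      over (x ∷ xs) = begin
        length (ext ++ exts) + (deadEnd x + dead)       ≡⟨ cong (_+ (deadEnd x + dead)) (length-++ ext) ⟩
        (length ext + length exts) + (deadEnd x + dead) ≡⟨ interchange (length ext) _ _ dead ⟩
        (length ext + deadEnd x) + (length exts + dead) ≡⟨ cong₂ _+_ (extensions-count da db) (over xs) ⟩
        (1 + special x) + (length xs + spec)            ≡⟨ interchange 1 (special x) (length xs) spec ⟩
        (1 + length xs) + (special x + spec)            ∎
        where
          da : Dec ((a ∷ x) ⊑ W)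
          da = (a ∷ x) ⊑? W
          db : Dec ((b ∷ x) ⊑ W)
          db = (b ∷ x) ⊑? W
          ext exts : List Word
          ext  = leftExtensions x
          exts = concatMap leftExtensions xs
          dead spec : ℕ
          dead = sum (map deadEnd xs)
          spec = sum (map special xs)

  complexity-full : complexity (length W) ≡ 1
  complexity-full = unique-constant-length (Factors-unique (length W))
    (Factors-complete (length W) refl ([] , [] , ++-identityʳ W))
    (λ x∈ → let |x|≡|W| , f = Factors-sound (length W) x∈ in full-length-factor f |x|≡|W|)

  specialCount-≥1 : LeftSpecial x W → 1 ≤ specialCount (length x)
  specialCount-≥1 {x} special-x@(fa , fb) =
    sum-≥1 special (Factors-complete (length x) refl (factor-++ʳ (a ∷ []) x fa))
           (both-≡1 ((a ∷ x) ⊑? W) ((b ∷ x) ⊑? W) fa fb)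

  prefix-specials : ∀ {S j} → LeftSpecial S W → j ≤ length S → 1 ≤ specialCount j
  prefix-specials {S} {j} special j≤|S| = subst (λ m → 1 ≤ specialCount m) (length-take≤ S j≤|S|)
                                                 (specialCount-≥1 (leftSpecial-take j special))

  specialCount-≥2 : LeftSpecial x W → LeftSpecial y W → length y ≡ length x → x ≢ y →
                    2 ≤ specialCount (length x)
  specialCount-≥2 {x} {y} (fa , fb) (ga , gb) |y|≡|x| x≢y =
    sum-≥2 special (Factors-complete (length x) refl (factor-++ʳ (a ∷ []) x fa))
           (Factors-complete (length x) |y|≡|x| (factor-++ʳ (a ∷ []) y ga)) x≢y
           (both-≡1 ((a ∷ x) ⊑? W) ((b ∷ x) ⊑? W) fa fb) (both-≡1 ((a ∷ y) ⊑? W) ((b ∷ y) ⊑? W) ga gb)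

  specialCount-≡0 : ∀ i → (∀ x → length x ≡ i → ¬ LeftSpecial x W) → specialCount i ≡ 0
  specialCount-≡0 i none = sum-≡0 special (Factors i) λ {x} x∈ → ¬≢0⇒≡0 (special x) λ ≢0 →
    none x (proj₁ (Factors-sound i x∈)) (both-≢0 ((a ∷ x) ⊑? W) ((b ∷ x) ⊑? W) ≢0)

  deadEndCount-≡0 : ∀ i → (∀ x → length x ≡ i → x ⊑ W → LeftExtendable x W) → deadEndCount i ≡ 0
  deadEndCount-≡0 i all-extendable = sum-≡0 deadEnd (Factors i) λ {x} x∈ →
    let |x|≡i , f = Factors-sound i x∈ in deadEnd-≡0 (all-extendable x |x|≡i f)

  deadEndCount-≡1 : ∀ {z} → z ⊑ W → ¬ LeftExtendable z W →
                    (∀ x → length x ≡ length z → x ⊑ W → ¬ LeftExtendable x W → x ≡ z) →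
                    deadEndCount (length z) ≡ 1
  deadEndCount-≡1 {z} fz ¬ext only-z =
    sum-≡1 deadEnd (Factors (length z)) (Factors-unique (length z)) (Factors-complete (length z) refl fz)
           (deadEnd-≡1 ¬ext)
           λ {x} x∈ ≢0 → let |x|≡ , f = Factors-sound (length z) x∈ in only-z x |x|≡ f (deadEnd-≢0 ≢0)

-- Counting under a left profile h: the dead ends of length i are none for i < h and
-- exactly the prefix of length i for h ≤ i ≤ |W|.  Summing the recurrence of
-- FactorCounting then shows that |W| − h is the number of left special factors of W.
module ProfileCounting (W : Word) {h : ℕ} (profile : LeftProfile W h) where
  open FactorCounting W

  private
    h≤|W| : h ≤ length W
    h≤|W| = proj₁ profile

  deadEnd⇒prefix : x ⊑ W → ¬ LeftExtendable x W → x ≡ take (length x) W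
  deadEnd⇒prefix {x} (p , s , e) ¬ext with ¬leftExtendable⇒prefix-occurrences ¬ext p s e
  ... | refl = trans (sym (take-length-++ x)) (cong (take (length x)) e)

  long-prefix-deadEnd : ∀ {i} → h ≤ i → ¬ LeftExtendable (take i W) W
  long-prefix-deadEnd {i} h≤i (c , f) = proj₂ (proj₂ profile) (c , subst (λ v → (c ∷ v) ⊑ W) take-h
    (factor-take (suc h) (c ∷ take i W) f))
    where
      take-h : take h (take i W) ≡ take h W
      take-h = trans (take-take h i W) (cong (λ m → take m W) (m≤n⇒m⊓n≡m h≤i))

  deadEndCount-below : ∀ {i} → i < h → deadEndCount i ≡ 0
  deadEndCount-below {i} i<h = deadEndCount-≡0 i extendable
    where
      extendable : ∀ x → length x ≡ i → x ⊑ W → LeftExtendable x W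
      extendable x |x|≡i f with leftExtendable? x W
      ... | yes ext  = ext
      ... | no ¬ext = subst (λ v → LeftExtendable v W)
                        (sym (trans (deadEnd⇒prefix f ¬ext) (cong (λ m → take m W) |x|≡i)))
                        (proj₁ (proj₂ profile) i i<h)

  deadEndCount-above : ∀ {i} → h ≤ i → i ≤ length W → deadEndCount i ≡ 1
  deadEndCount-above {i} h≤i i≤|W| = subst (λ m → deadEndCount m ≡ 1) (length-take≤ W i≤|W|)
    (deadEndCount-≡1 (prefix⇒factor (take-isPrefix i W)) (long-prefix-deadEnd h≤i) only-prefix)
    where
      only-prefix : ∀ x → length x ≡ length (take i W) → x ⊑ W → ¬ LeftExtendable x W → x ≡ take i W
      only-prefix x |x|≡ f ¬ext =
        trans (deadEnd⇒prefix f ¬ext) (cong (λ m → take m W) (trans |x|≡ (length-take≤ W i≤|W|)))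

  excess-step : ∀ i → i < length W → suc i ∸ h ≡ deadEndCount i + (i ∸ h)
  excess-step i i<|W| with i <? h
  ... | yes i<h =
    trans (m≤n⇒m∸n≡0 i<h) (sym (cong₂ _+_ (deadEndCount-below i<h) (m≤n⇒m∸n≡0 (<⇒≤ i<h))))
  ... | no i≮h  =
    trans (+-∸-assoc 1 (≮⇒≥ i≮h)) (cong (_+ (i ∸ h)) (sym (deadEndCount-above (≮⇒≥ i≮h) (<⇒≤ i<|W|))))

  telescope : ∀ i → i ≤ length W → complexity i + (i ∸ h) ≡ 1 + Σ< specialCount i
  telescope zero    _       = cong suc (0∸n≡0 h)
  telescope (suc i) si≤|W| = begin
    complexity (suc i) + (suc i ∸ h)
      ≡⟨ cong (complexity (suc i) +_) (excess-step i si≤|W|) ⟩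
    complexity (suc i) + (deadEndCount i + (i ∸ h))
      ≡⟨ sym (+-assoc (complexity (suc i)) _ _) ⟩
    complexity (suc i) + deadEndCount i + (i ∸ h)
      ≡⟨ cong (_+ (i ∸ h)) (extension-recurrence i) ⟩
    complexity i + specialCount i + (i ∸ h)
      ≡⟨ xy∙z≈xz∙y (complexity i) _ _ ⟩
    complexity i + (i ∸ h) + specialCount i
      ≡⟨ cong (_+ specialCount i) (telescope i (<⇒≤ si≤|W|)) ⟩
    1 + Σ< specialCount i + specialCount i
      ∎
    where open ≡-Reasoning

  excess-length : length W ∸ h ≡ Σ< specialCount (length W)
  excess-length = +-cancelˡ-≡ 1 (length W ∸ h) (Σ< specialCount (length W))
    (trans (cong (_+ (length W ∸ h)) (sym complexity-full)) (telescope (length W) ≤-refl))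

  -- A left special factor S yields a left special factor of each length ≤ |S|, so
  -- h + |S| + 1 ≤ |W|.
  lower-bound : ∀ {S} → LeftSpecial S W → h + suc (length S) ≤ length W
  lower-bound {S} special = begin
    h + k                          ≤⟨ +-monoʳ-≤ h (Σ<-≥ specialCount k (λ j → prefix-specials special ∘ ≤-pred)) ⟩
    h + Σ< specialCount k          ≤⟨ +-monoʳ-≤ h (Σ<-mono specialCount k≤|W|) ⟩
    h + Σ< specialCount (length W) ≡⟨ cong (h +_) (sym excess-length) ⟩
    h + (length W ∸ h)             ≡⟨ m+[n∸m]≡n h≤|W| ⟩
    length W                       ∎
    where
      open ≤-Reasoning
      k : ℕ
      k = suc (length S)
      k≤|W| : k ≤ length W
      k≤|W| = factor-length (proj₁ special)

  -- Up to length h the telescoped recurrence reads d(k) = 1 + Σ< specialCount k, so the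
  -- complexity bound d(k) ≤ k + 1 leaves room for at most k left special factors below k.
  few-specials : LowComplexity W → ∀ {k} → k ≤ h → k ≤ length W → Σ< specialCount k ≤ k
  few-specials low {k} k≤h k≤|W| = ≤-pred (begin
    1 + Σ< specialCount k     ≡⟨ sym (telescope k k≤|W|) ⟩
    complexity k + (k ∸ h)    ≡⟨ cong (complexity k +_) (m≤n⇒m∸n≡0 k≤h) ⟩
    complexity k + 0          ≡⟨ +-identityʳ (complexity k) ⟩
    complexity k              ≤⟨ low k (Factors k) (Factors-unique k) (Factors-sound k) ⟩
    suc k                     ∎)
    where open ≤-Reasoning

  -- From now on S is a left special factor shorter than h in a word of low complexity.
  module _ {S} (low : LowComplexity W) (special : LeftSpecial S W) (k≤h : suc (length S) ≤ h) where

    private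
      k≤|W| : suc (length S) ≤ length W
      k≤|W| = factor-length (proj₁ special)

    -- The prefixes of S already give a left special factor of each length below |S|, so S
    -- is the only left special factor of its length.
    only-special : LeftSpecial x W → length x ≡ length S → x ≡ S
    only-special {x} special-x |x|≡|S| with S ≟ᵂ x
    ... | yes S≡x = sym S≡x
    ... | no S≢x  = ⊥-elim (1+n≰n (≤-trans (specialCount-≥2 special special-x |x|≡|S| S≢x) one-special))
      where
        one-special : specialCount (length S) ≤ 1
        one-special = +-cancelˡ-≤ (length S) (specialCount (length S)) 1 (begin
          length S + specialCount (length S)
            ≤⟨ +-monoˡ-≤ _ (Σ<-≥ specialCount (length S) (λ j → prefix-specials special ∘ <⇒≤)) ⟩
          Σ< specialCount (length S) + specialCount (length S)
            ≤⟨ few-specials low k≤h k≤|W| ⟩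
          suc (length S)
            ≡⟨ +-comm 1 (length S) ⟩
          length S + 1
            ∎)
          where open ≤-Reasoning

    -- If moreover dS has no right extension, no left special factor x is longer than S:
    -- x would begin with Sc for some letter c, making dSc a factor.
    no-longer-special : ∀ {d} → ¬ RightExtendable (d ∷ S) W → LeftSpecial x W →
                        suc (length S) ≤ length x → ⊥
    no-longer-special {x} {d} ¬ext special-x k≤|x| with drop (length S) x in eq
    ... | []    = <⇒≱ k≤|x| (m∸n≡0⇒m≤n (trans (sym (length-drop (length S) x)) (cong length eq)))
    ... | c ∷ r = ¬ext (c , factor-++ˡ (d ∷ S ++ c ∷ []) r
                                       (subst (_⊑ W) dx≡dScr (leftSpecial-extension d special-x)))
      where
        S≡ : take (length S) x ≡ S
        S≡ = only-special (leftSpecial-take (length S) special-x) (length-take≤ x (<⇒≤ k≤|x|))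
        dx≡dScr : d ∷ x ≡ (d ∷ S ++ c ∷ []) ++ r
        dx≡dScr = cong (d ∷_) (trans (sym (take++drop≡id (length S) x))
                                     (trans (cong₂ _++_ S≡ eq) (sym (++-assoc S (c ∷ []) r))))

    -- Then all left special factors have length at most |S|, and |W| ≤ h + |S| + 1.
    upper-bound : ∀ {d} → ¬ RightExtendable (d ∷ S) W → length W ≤ h + suc (length S)
    upper-bound ¬ext = begin
      length W                               ≡⟨ sym (m+[n∸m]≡n h≤|W|) ⟩
      h + (length W ∸ h)                     ≡⟨ cong (h +_) excess-length ⟩
      h + Σ< specialCount (length W)         ≡⟨ cong (h +_) (Σ<-stable specialCount none-longer k≤|W|) ⟩
      h + Σ< specialCount (suc (length S))   ≤⟨ +-monoʳ-≤ h (few-specials low k≤h k≤|W|) ⟩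
      h + suc (length S)                     ∎
      where
        open ≤-Reasoning
        none-longer : ∀ j → suc (length S) ≤ j → specialCount j ≡ 0
        none-longer j k≤j = specialCount-≡0 j λ x |x|≡j special-x →
          no-longer-special ¬ext special-x (subst (suc (length S) ≤_) (sym |x|≡j) k≤j)

-- The mirror image of the upper bound, obtained by applying it to the reversal of W:
-- the right special prefix P plays the role of S.
upper-bound-reverse : ∀ {k P c} → LowComplexity W → RightProfile W k → RightSpecial P W →
                      ¬ LeftExtendable (P ++ c ∷ []) W → suc (length P) ≤ k →
                      length W ≤ k + suc (length P)
upper-bound-reverse {W} {k} {P} {c} low profile special ¬ext h≤k =
  subst₂ _≤_ (length-reverse W) (cong (λ m → k + suc m) (length-reverse P))
    (ProfileCounting.upper-bound (reverse W) (RightProfile⇒LeftProfile-reverse profile)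
       (lowComplexity-reverse low) (rightSpecial-reverse special)
       (subst (λ m → suc m ≤ k) (sym (length-reverse P)) h≤k) ¬ext′)
  where
    ¬ext′ : ¬ RightExtendable (c ∷ reverse P) (reverse W)
    ¬ext′ ext = ¬ext (rightExtendable-unreverse
                  (subst (λ v → RightExtendable v (reverse W)) (sym (reverse-snoc P c)) ext))

-- The lower bound comes from the left special suffix S = suffixOf (K_W − 1) W; the upper
-- bound from S when K_W ≤ H_W, and from the right special prefix take (H_W − 1) W otherwise.
open-length : ∀ {i j} → LowComplexity W → Open W → IsH W (suc i) → IsK W (suc j) →
              length W ≡ suc i + suc j
open-length {W} {i} {j} low open-W isH isK with suffixOf-suc W (proj₁ isK) | take-snoc W (proj₁ isH)
... | d , v≡dS | c , u≡Pc = ≤-antisym upper lower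
  where
    S P : Word
    S = suffixOf j W
    P = take i W
    |S|≡j : length S ≡ j
    |S|≡j = suffixOf-length W (≤-trans (n≤1+n j) (proj₁ isK))
    |P|≡i : length P ≡ i
    |P|≡i = length-take≤ W (≤-trans (n≤1+n i) (proj₁ isH))
    S-special : LeftSpecial S W
    S-special = open⇒leftSpecial-suffix open-W isK
    left : LeftProfile W (suc i)
    left = IsH⇒LeftProfile isH
    right : RightProfile W (suc j)
    right = IsK⇒RightProfile isK
    dS-dead : ¬ RightExtendable (d ∷ S) W
    dS-dead = subst (λ v → ¬ RightExtendable v W) v≡dS (proj₂ (proj₂ right))
    Pc-dead : ¬ LeftExtendable (P ++ c ∷ []) W
    Pc-dead = subst (λ u → ¬ LeftExtendable u W) u≡Pc (proj₂ (proj₂ left))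
    open ProfileCounting W left

    lower : suc i + suc j ≤ length W
    lower = subst (λ m → suc i + suc m ≤ length W) |S|≡j (lower-bound S-special)

    upper : length W ≤ suc i + suc j
    upper with ≤-total (suc j) (suc i)
    ... | inj₁ k≤h = subst (λ m → length W ≤ suc i + suc m) |S|≡j
          (upper-bound low S-special (subst (λ m → suc m ≤ suc i) (sym |S|≡j) k≤h) dS-dead)
    ... | inj₂ h≤k = subst (length W ≤_) (trans (cong (λ m → suc j + suc m) |P|≡i) (+-comm (suc j) _))
          (upper-bound-reverse low right (open⇒rightSpecial-prefix open-W isH) Pc-dead
             (subst (λ m → suc m ≤ suc j) (sym |P|≡i) h≤k))

-- The empty word is unrepeated only in the empty word, so H_W and K_W are positive.
empty-unrepeated : Unrepeated [] W → W ≡ []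
empty-unrepeated {W} once = length≡0⇒[] (suc-injective (trans (sym (occ-[] W)) once))

suffixOf-zero : ∀ (W : Word) → suffixOf 0 W ≡ []
suffixOf-zero W = drop-all (length W ∸ 0) W ≤-refl

split-at : ∀ {h k} → length W ≡ h + k → W ≡ take h W ++ suffixOf k W
split-at {W} {h} {k} |W|≡h+k = sym (begin
  take h W ++ drop (length W ∸ k) W  ≡⟨ cong (λ m → take h W ++ drop m W) |W|∸k≡h ⟩
  take h W ++ drop h W               ≡⟨ take++drop≡id h W ⟩
  W                                  ∎)
  where
    open ≡-Reasoning
    |W|∸k≡h : length W ∸ k ≡ h
    |W|∸k≡h = trans (cong (_∸ k) |W|≡h+k) (m+n∸n≡m h k)

corollary2 : (w : Word) → w ≢ [] → Sturmian w → Open w →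
    (h k : ℕ) → IsH w h → IsK w k →
    (length w ≡ h + k) × (w ≡ take h w ++ suffixOf k w)
corollary2 w w≢[] sturmian open-w zero    k       isH isK =
  ⊥-elim (w≢[] (empty-unrepeated (proj₁ (proj₂ isH))))
corollary2 w w≢[] sturmian open-w (suc i) zero    isH isK =
  ⊥-elim (w≢[] (empty-unrepeated (subst (λ v → Unrepeated v w) (suffixOf-zero w) (proj₁ (proj₂ isK)))))
corollary2 w w≢[] sturmian open-w (suc i) (suc j) isH isK = |w|≡h+k , split-at {h = suc i} |w|≡h+k
  where
    |w|≡h+k : length w ≡ suc i + suc j
    |w|≡h+k = open-length (sturmian⇒lowComplexity sturmian) open-w isH isK
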